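{- Let $n$ be a positive integer and $\delta \geq 2$ an even integer such that both $n$ and $n+\delta$ are perfect numbers. Then $\delta \nmid n$.
   Context: A positive integer $N$ is perfect if $\sigma(N) = 2N$, where $\sigma$ denotes the sum-of-divisors function. -}

module Defs where

open import Data.Nat using (ℕ; suc; _*_)
open import Data.Nat.Divisibility using (_∣_; _∣?_)
open import Data.List using (List; filter; map; upTo)
open import Data.Nat.ListAction using (sum)
open import Relation.Binary.PropositionalEquality using (_≡_)

divisors : ℕ → List ℕ
divisors N = filter (_∣? N) (map suc (upTo N))

σ : ℕ → ℕ
σ N = sum (divisors N)

-- N is perfect iff σ(N) = 2N (positivity of N is required separately)
Perfect : ℕ → Set
Perfect N = σ N ≡ 2 * N

module Submission where

-- If n and n + δ are perfect, δ ≥ 2 is even and δ ∣ n, then both numbers are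
-- even, so by Euler's theorem each is 2^(e+1)·M with M = 2^(e+2) − 1 prime.
--
-- 1. Divisor sums.  σ is rewritten as a range sum ∑_{d ≤ N, d ∣ N} d, which
--    splits into odd and even divisors.  This gives σ(2N) = σ_odd(N) + 2σ(N)
--    and σ_odd(2N) = σ_odd(N), hence σ(2^a·m) + σ(m) = 2^(a+1)·σ(m) for odd m.
-- 2. Euler.  If 2^(a+1)·m is perfect with m odd, then σ(m) = m + 1 and
--    m = 2^(a+2) − 1, because a divisor 1 < c < m would push σ(m) too high.
-- 3. Main argument.  Write δ = 2^(i+1)·o with o odd and n = k·δ.  The odd part
--    o·t′ of each perfect multiple t·δ (t = k, k + 1) is a Mersenne prime.
--    If o ≠ 1 then o equals both Mersenne primes, so n = n + δ.  If o = 1 then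
--    one of k, k + 1 is odd, and comparing the two Mersenne equations via the
--    uniqueness of the 2-adic decomposition yields a contradiction.

open import Defs
open import Data.Nat
open import Data.Nat.Properties
open import Data.Nat.Divisibility
open import Data.Nat.Coprimality using (Coprime; coprime-divisor)
open import Data.Nat.Primality using (Irreducible; irreducible[2]; euclidsLemma; prime[2])
open import Data.Nat.Induction using (<-wellFounded)
open import Data.Nat.Solver using (module +-*-Solver)
open import Induction.WellFounded using (Acc; acc)
open import Data.Nat.ListAction using (sum)
open import Data.Nat.ListAction.Properties using (sum-++)
open import Data.List using (List; []; _∷_; [_]; _∷ʳ_; filter; map; upTo; applyUpTo)
open import Data.List.Properties using (applyUpTo-∷ʳ; map-applyUpTo; map-upTo)
open import Data.Product using (Σ-syntax; _×_; _,_)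
open import Data.Sum using (inj₁; inj₂)
open import Data.Empty using (⊥; ⊥-elim)
open import Function using (_∘_)
open import Relation.Nullary using (¬_; Dec; yes; no)
open import Relation.Binary.PropositionalEquality hiding ([_])
open import Algebra.Properties.CommutativeSemigroup +-commutativeSemigroup using (interchange)

Odd : ℕ → Set
Odd n = ¬ 2 ∣ n

odd-suc : ∀ {x} → 2 ∣ x → Odd (suc x)
odd-suc {x} 2∣x 2∣1+x with ∣1⇒≡1 (∣m+n∣m⇒∣n (subst (2 ∣_) (+-comm 1 x) 2∣1+x) 2∣x)
... | ()

odd⇒positive : ∀ {m} → Odd m → 1 ≤ m
odd⇒positive {zero}  odd = ⊥-elim (odd (2 ∣0))
odd⇒positive {suc m} _   = s≤s z≤n

odd-* : ∀ {x y} → Odd x → Odd y → Odd (x * y)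
odd-* {x} {y} odd-x odd-y 2∣xy with euclidsLemma x y prime[2] 2∣xy
... | inj₁ 2∣x = odd-x 2∣x
... | inj₂ 2∣y = odd-y 2∣y

odd∣double⇒∣ : ∀ {d N} → Odd d → d ∣ 2 * N → d ∣ N
odd∣double⇒∣ {d} odd = coprime-divisor coprime
  where
  coprime : Coprime d 2
  coprime (e∣d , e∣2) with irreducible[2] e∣2
  ... | inj₁ e≡1 = e≡1
  ... | inj₂ refl = ⊥-elim (odd e∣d)

pow-suc : ∀ a m → 2 ^ suc a * m ≡ 2 * (2 ^ a * m)
pow-suc a m = *-assoc 2 (2 ^ a) m

even-pow : ∀ a m → 2 ∣ 2 ^ suc a * m
even-pow a m = subst (2 ∣_) (sym (pow-suc a m)) (m∣m*n (2 ^ a * m))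

2^a*m-positive : ∀ a {m} → 1 ≤ m → 1 ≤ 2 ^ a * m
2^a*m-positive a m≥1 = ≤-trans m≥1 (m≤n*m _ (2 ^ a) {{m^n≢0 2 a}})

-- Finite sums ∑ f k = f 0 + … + f (k − 1)

∑ : (ℕ → ℕ) → ℕ → ℕ
∑ f zero    = 0
∑ f (suc k) = ∑ f k + f k

∑-applyUpTo : ∀ f k → sum (applyUpTo f k) ≡ ∑ f k
∑-applyUpTo f zero    = refl
∑-applyUpTo f (suc k) = begin
  sum (applyUpTo f (suc k))       ≡⟨ cong sum (sym (applyUpTo-∷ʳ f k)) ⟩
  sum (applyUpTo f k ∷ʳ f k)      ≡⟨ sum-++ (applyUpTo f k) [ f k ] ⟩
  sum (applyUpTo f k) + (f k + 0) ≡⟨ cong₂ _+_ (∑-applyUpTo f k) (+-identityʳ (f k)) ⟩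
  ∑ f k + f k                     ∎
  where open ≡-Reasoning

∑-cong : ∀ {f h} → (∀ e → f e ≡ h e) → ∀ k → ∑ f k ≡ ∑ h k
∑-cong f≗h zero    = refl
∑-cong f≗h (suc k) = cong₂ _+_ (∑-cong f≗h k) (f≗h k)

∑-zero : ∀ {f} → (∀ e → f e ≡ 0) → ∀ k → ∑ f k ≡ 0
∑-zero f≗0 zero    = refl
∑-zero f≗0 (suc k) = cong₂ _+_ (∑-zero f≗0 k) (f≗0 k)

∑-*ˡ : ∀ c f k → ∑ (λ e → c * f e) k ≡ c * ∑ f k
∑-*ˡ c f zero    = sym (*-zeroʳ c)
∑-*ˡ c f (suc k) = trans (cong (_+ c * f k) (∑-*ˡ c f k)) (sym (*-distribˡ-+ c (∑ f k) (f k)))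

∑-evenOdd : ∀ f k → ∑ f (2 * k) ≡ ∑ (λ e → f (2 * e)) k + ∑ (λ e → f (suc (2 * e))) k
∑-evenOdd f zero    = refl
∑-evenOdd f (suc k) = begin
  ∑ f (2 * suc k)                     ≡⟨ cong (∑ f) (*-suc 2 k) ⟩
  ∑ f (2 * k) + f (2 * k) + f (suc (2 * k))
    ≡⟨ +-assoc (∑ f (2 * k)) _ _ ⟩
  ∑ f (2 * k) + (f (2 * k) + f (suc (2 * k)))
    ≡⟨ cong (_+ (f (2 * k) + f (suc (2 * k)))) (∑-evenOdd f k) ⟩
  (E + O) + (f (2 * k) + f (suc (2 * k)))
    ≡⟨ interchange E O _ _ ⟩
  (E + f (2 * k)) + (O + f (suc (2 * k))) ∎
  where
  open ≡-Reasoning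
  E O : ℕ
  E = ∑ (λ e → f (2 * e)) k
  O = ∑ (λ e → f (suc (2 * e))) k

∑-mono : ∀ f {j k} → j ≤ k → ∑ f j ≤ ∑ f k
∑-mono f {k = zero}  z≤n = ≤-refl
∑-mono f {k = suc k} j≤1+k with m≤n⇒m<n∨m≡n j≤1+k
... | inj₂ refl      = ≤-refl
... | inj₁ (s≤s j≤k) = ≤-trans (∑-mono f j≤k) (m≤m+n _ _)

∑-stable : ∀ f {j} → (∀ e → j ≤ e → f e ≡ 0) → ∀ {k} → j ≤ k → ∑ f k ≡ ∑ f j
∑-stable f f≗0 {zero}  z≤n = refl
∑-stable f f≗0 {suc k} j≤1+k with m≤n⇒m<n∨m≡n j≤1+k
... | inj₂ refl      = refl
... | inj₁ (s≤s j≤k) = trans (cong₂ _+_ (∑-stable f f≗0 j≤k) (f≗0 k j≤k)) (+-identityʳ _)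

-- Divisor sums

divisorPart : ℕ → ℕ → ℕ
divisorPart N d with d ∣? N
... | yes _ = d
... | no  _ = 0

divisorPart-∣ : ∀ {N d} → d ∣ N → divisorPart N d ≡ d
divisorPart-∣ {N} {d} d∣N with d ∣? N
... | yes _   = refl
... | no  d∤N = ⊥-elim (d∤N d∣N)

divisorPart-∤ : ∀ {N d} → ¬ d ∣ N → divisorPart N d ≡ 0
divisorPart-∤ {N} {d} d∤N with d ∣? N
... | yes d∣N = ⊥-elim (d∤N d∣N)
... | no  _   = refl

divisorPart-beyond : ∀ {N d} → 1 ≤ N → N < d → divisorPart N d ≡ 0
divisorPart-beyond {suc _} _ N<d = divisorPart-∤ (λ d∣N → <⇒≱ N<d (∣⇒≤ d∣N))

divisorPart-double : ∀ N e → divisorPart (2 * N) (2 * e) ≡ 2 * divisorPart N e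
divisorPart-double N e with e ∣? N
... | yes e∣N = divisorPart-∣ (*-monoʳ-∣ 2 e∣N)
... | no  e∤N = trans (divisorPart-∤ (λ 2e∣2N → e∤N (*-cancelˡ-∣ 2 2e∣2N))) (sym (*-zeroʳ 2))

divisorPart-odd : ∀ N {d} → Odd d → divisorPart (2 * N) d ≡ divisorPart N d
divisorPart-odd N {d} odd with d ∣? N
... | yes d∣N = divisorPart-∣ (∣-trans d∣N (n∣m*n 2))
... | no  d∤N = divisorPart-∤ (λ d∣2N → d∤N (odd∣double⇒∣ odd d∣2N))

sum-filter-∣ : ∀ N xs → sum (filter (_∣? N) xs) ≡ sum (map (divisorPart N) xs)
sum-filter-∣ N []       = refl
sum-filter-∣ N (x ∷ xs) with x ∣? N
... | yes _ = cong (x +_) (sum-filter-∣ N xs)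
... | no  _ = sum-filter-∣ N xs

-- sum of the divisors d ≤ k of N
divisorSum : ℕ → ℕ → ℕ
divisorSum N = ∑ (divisorPart N ∘ suc)

-- sums of the odd divisors d < 2k and of the even divisors d ≤ 2k of N
oddDivisorSum evenDivisorSum : ℕ → ℕ → ℕ
oddDivisorSum  N = ∑ (λ e → divisorPart N (suc (2 * e)))
evenDivisorSum N = ∑ (λ e → divisorPart N (2 * suc e))

σ-divisorSum : ∀ N → σ N ≡ divisorSum N N
σ-divisorSum N = begin
  sum (filter (_∣? N) (map suc (upTo N)))      ≡⟨ sum-filter-∣ N (map suc (upTo N)) ⟩
  sum (map (divisorPart N) (map suc (upTo N))) ≡⟨ cong (sum ∘ map (divisorPart N)) (map-upTo suc N) ⟩
  sum (map (divisorPart N) (applyUpTo suc N))  ≡⟨ cong sum (map-applyUpTo suc (divisorPart N) N) ⟩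
  sum (applyUpTo (divisorPart N ∘ suc) N)      ≡⟨ ∑-applyUpTo _ N ⟩
  divisorSum N N                               ∎
  where open ≡-Reasoning

divisorSum-split : ∀ N k → divisorSum N (2 * k) ≡ oddDivisorSum N k + evenDivisorSum N k
divisorSum-split N k = trans (∑-evenOdd (divisorPart N ∘ suc) k)
  (cong (oddDivisorSum N k +_) (∑-cong (λ e → cong (divisorPart N) (sym (*-suc 2 e))) k))

divisorSum-beyond : ∀ {N k} → 1 ≤ N → N ≤ k → divisorSum N k ≡ divisorSum N N
divisorSum-beyond N≥1 = ∑-stable _ (λ e N≤e → divisorPart-beyond N≥1 (s≤s N≤e))

oddDivisorSum-beyond : ∀ {N k} → 1 ≤ N → N ≤ k → oddDivisorSum N k ≡ oddDivisorSum N N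
oddDivisorSum-beyond N≥1 =
  ∑-stable _ (λ e N≤e → divisorPart-beyond N≥1 (s≤s (≤-trans N≤e (m≤m+n e (e + 0)))))

σ-odd : ℕ → ℕ
σ-odd N = oddDivisorSum N N

n≤2*n : ∀ N → N ≤ 2 * N
n≤2*n N = m≤m+n N (N + 0)

-- σ(2N) = σ_odd(N) + 2σ(N): odd divisors of 2N are those of N, even ones are 2e with e ∣ N
σ-double : ∀ N → σ (2 * N) ≡ σ-odd N + 2 * σ N
σ-double N = begin
  σ (2 * N)                                             ≡⟨ σ-divisorSum (2 * N) ⟩
  divisorSum (2 * N) (2 * N)                            ≡⟨ divisorSum-split (2 * N) N ⟩
  oddDivisorSum (2 * N) N + evenDivisorSum (2 * N) N
    ≡⟨ cong₂ _+_ (∑-cong (λ e → divisorPart-odd N (odd-suc (m∣m*n e))) N)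
                 (∑-cong (λ e → divisorPart-double N (suc e)) N) ⟩
  σ-odd N + ∑ (λ e → 2 * divisorPart N (suc e)) N       ≡⟨ cong (σ-odd N +_) (∑-*ˡ 2 _ N) ⟩
  σ-odd N + 2 * divisorSum N N                          ≡⟨ cong (λ s → σ-odd N + 2 * s) (sym (σ-divisorSum N)) ⟩
  σ-odd N + 2 * σ N                                     ∎
  where open ≡-Reasoning

σ-odd-double : ∀ {N} → 1 ≤ N → σ-odd (2 * N) ≡ σ-odd N
σ-odd-double {N} N≥1 = begin
  oddDivisorSum (2 * N) (2 * N) ≡⟨ ∑-cong (λ e → divisorPart-odd N (odd-suc (m∣m*n e))) (2 * N) ⟩
  oddDivisorSum N (2 * N)       ≡⟨ oddDivisorSum-beyond N≥1 (n≤2*n N) ⟩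
  oddDivisorSum N N             ∎
  where open ≡-Reasoning

-- an odd number has only odd divisors
σ-of-odd : ∀ {m} → Odd m → σ m ≡ σ-odd m
σ-of-odd {m} odd = begin
  σ m                                        ≡⟨ σ-divisorSum m ⟩
  divisorSum m m                             ≡⟨ sym (divisorSum-beyond m≥1 (n≤2*n m)) ⟩
  divisorSum m (2 * m)                       ≡⟨ divisorSum-split m m ⟩
  σ-odd m + evenDivisorSum m m               ≡⟨ cong (σ-odd m +_) (∑-zero even-vanish m) ⟩
  σ-odd m + 0                                ≡⟨ +-identityʳ _ ⟩
  σ-odd m                                    ∎
  where
  open ≡-Reasoning
  m≥1 : 1 ≤ m
  m≥1 = odd⇒positive odd
  even-vanish : ∀ e → divisorPart m (2 * suc e) ≡ 0
  even-vanish e = divisorPart-∤ (λ 2e∣m → odd (∣-trans (m∣m*n (suc e)) 2e∣m))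

-- the odd divisors of 2^a·m are those of m, which for odd m are all its divisors
σ-odd-pow : ∀ a {m} → Odd m → σ-odd (2 ^ a * m) ≡ σ m
σ-odd-pow zero    {m} odd = trans (cong σ-odd (*-identityˡ m)) (sym (σ-of-odd odd))
σ-odd-pow (suc a) {m} odd = begin
  σ-odd (2 ^ suc a * m)   ≡⟨ cong σ-odd (pow-suc a m) ⟩
  σ-odd (2 * (2 ^ a * m)) ≡⟨ σ-odd-double (2^a*m-positive a (odd⇒positive odd)) ⟩
  σ-odd (2 ^ a * m)       ≡⟨ σ-odd-pow a odd ⟩
  σ m                     ∎
  where open ≡-Reasoning

-- multiplicativity on 2^a·m in the form σ(2^a·m) = (2^(a+1) − 1)·σ(m), m odd
σ-pow : ∀ a {m} → Odd m → σ (2 ^ a * m) + σ m ≡ 2 ^ suc a * σ m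
σ-pow zero    {m} odd = cong₂ _+_ (cong σ (*-identityˡ m)) (sym (*-identityˡ (σ m)))
σ-pow (suc a) {m} odd = begin
  σ (2 ^ suc a * m) + σ m             ≡⟨ cong (λ x → σ x + σ m) (pow-suc a m) ⟩
  σ (2 * X) + σ m                     ≡⟨ cong (_+ σ m) (σ-double X) ⟩
  σ-odd X + 2 * σ X + σ m             ≡⟨ cong (λ y → y + 2 * σ X + σ m) (σ-odd-pow a odd) ⟩
  σ m + 2 * σ X + σ m                 ≡⟨ regroup (σ m) (σ X) ⟩
  2 * (σ X + σ m)                     ≡⟨ cong (2 *_) (σ-pow a odd) ⟩
  2 * (2 ^ suc a * σ m)               ≡⟨ sym (pow-suc (suc a) (σ m)) ⟩
  2 ^ suc (suc a) * σ m               ∎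
  where
  open ≡-Reasoning
  X : ℕ
  X = 2 ^ a * m
  regroup : ∀ s t → s + 2 * t + s ≡ 2 * (t + s)
  regroup = solve 2 (λ s t → s :+ con 2 :* t :+ s := con 2 :* (t :+ s)) refl
    where open +-*-Solver

-- Euler's theorem on even perfect numbers

-- a divisor 1 < d < N contributes to σ N on top of the divisors 1 and N
σ-nontrivial-divisor : ∀ {N d} → d ∣ N → 1 < d → d < N → d + N < σ N
σ-nontrivial-divisor {N@(suc N′)} {d@(suc d′)} d∣N (s≤s 1≤d′) (s≤s d≤N′) = begin-strict
  d + N                         ≡⟨ cong (_+ N) (sym (+-identityʳ d)) ⟩
  d + 0 + N                     <⟨ +-monoˡ-< N (+-monoʳ-< d one-divides) ⟩
  d + divisorSum N d′ + N       ≡⟨ cong (_+ N) (+-comm d _) ⟩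
  divisorSum N d′ + d + N       ≡⟨ cong (λ x → divisorSum N d′ + x + N) (sym (divisorPart-∣ d∣N)) ⟩
  divisorSum N d + N            ≤⟨ +-monoˡ-≤ N (∑-mono _ d≤N′) ⟩
  divisorSum N N′ + N           ≡⟨ cong (divisorSum N N′ +_) (sym (divisorPart-∣ (∣-refl {N}))) ⟩
  divisorSum N N                ≡⟨ sym (σ-divisorSum N) ⟩
  σ N                           ∎
  where
  open ≤-Reasoning
  one-divides : 0 < divisorSum N d′
  one-divides = ≤-trans (≤-reflexive (sym (divisorPart-∣ (1∣ N)))) (∑-mono _ 1≤d′)

-- σ m = m + 1 leaves room only for the divisors 1 and m
σ≡m+1⇒irreducible : ∀ {m} → 1 ≤ m → σ m ≡ m + 1 → Irreducible m
σ≡m+1⇒irreducible m≥1 σm≡m+1 {zero} 0∣m = ⊥-elim (<⇒≢ m≥1 (sym (0∣⇒≡0 0∣m)))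
σ≡m+1⇒irreducible m≥1 σm≡m+1 {1}    _   = inj₁ refl
σ≡m+1⇒irreducible {m} m≥1 σm≡m+1 {d@(suc (suc _))} d∣m
  with m≤n⇒m<n∨m≡n (∣⇒≤ {{>-nonZero m≥1}} d∣m)
... | inj₂ d≡m = inj₂ d≡m
... | inj₁ d<m = ⊥-elim (<⇒≱ (σ-nontrivial-divisor d∣m (s≤s (s≤s z≤n)) d<m) too-small)
  where
  too-small : σ m ≤ d + m
  too-small = subst (_≤ d + m) (trans (+-comm 1 m) (sym σm≡m+1)) (+-monoˡ-≤ m (s≤s z≤n))

mersenne-equation : ∀ R m s → suc R * m + s ≡ suc R * s → Σ[ c ∈ ℕ ] (s ≡ m + c × m ≡ R * c)
mersenne-equation R m s eq = s ∸ m , s≡m+c , m≡Rc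
  where
  open ≡-Reasoning
  m≤s : m ≤ s
  m≤s = *-cancelˡ-≤ (suc R) (≤-trans (m≤m+n (suc R * m) s) (≤-reflexive eq))
  c : ℕ
  c = s ∸ m
  s≡m+c : s ≡ m + c
  s≡m+c = sym (m+[n∸m]≡n m≤s)
  m+c≡c+Rc : m + c ≡ c + R * c
  m+c≡c+Rc = +-cancelˡ-≡ (suc R * m) (m + c) (suc R * c) (begin
    suc R * m + (m + c) ≡⟨ cong (suc R * m +_) (sym s≡m+c) ⟩
    suc R * m + s       ≡⟨ eq ⟩
    suc R * s           ≡⟨ cong (suc R *_) s≡m+c ⟩
    suc R * (m + c)     ≡⟨ *-distribˡ-+ (suc R) m c ⟩
    suc R * m + suc R * c ∎)
  m≡Rc : m ≡ R * c
  m≡Rc = +-cancelʳ-≡ c m (R * c) (trans m+c≡c+Rc (+-comm c (R * c)))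

-- in that situation c = 1, since otherwise c would be a divisor 1 < c < m of m
excess-is-one : ∀ {R m c} → 1 ≤ m → 2 ≤ R → σ m ≡ m + c → m ≡ R * c → c ≡ 1
excess-is-one {R} {m} {c} m≥1 R≥2 σm≡m+c m≡Rc with c ≟ 1
... | yes c≡1 = c≡1
... | no  c≢1 = ⊥-elim (<⇒≢ (σ-nontrivial-divisor c∣m 1<c c<m) (sym (trans σm≡m+c (+-comm m c))))
  where
  c≢0 : c ≢ 0
  c≢0 c≡0 = <⇒≢ m≥1 (sym (trans m≡Rc (trans (cong (R *_) c≡0) (*-zeroʳ R))))
  1<c : 1 < c
  1<c = ≤∧≢⇒< (n≢0⇒n>0 c≢0) (c≢1 ∘ sym)
  c∣m : c ∣ m
  c∣m = divides R m≡Rc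
  c<m : c < m
  c<m = subst (c <_) (sym m≡Rc) (begin-strict
    c      <⟨ m<m*n c 2 {{≢-nonZero c≢0}} (s≤s (s≤s z≤n)) ⟩
    c * 2  ≤⟨ *-monoʳ-≤ c R≥2 ⟩
    c * R  ≡⟨ *-comm c R ⟩
    R * c  ∎)
    where open ≤-Reasoning

evenPerfect⇒mersenne : ∀ a {m} → Odd m → Perfect (2 ^ suc a * m) →
  (m + 1 ≡ 2 ^ suc (suc a)) × Irreducible m
evenPerfect⇒mersenne a {m} odd perfect = conclude (mersenne-equation R m (σ m) perfect-equation)
  where
  open ≡-Reasoning
  m≥1 : 1 ≤ m
  m≥1 = odd⇒positive odd
  P R : ℕ
  P = 2 ^ suc (suc a)
  R = pred P
  1+R≡P : suc R ≡ P
  1+R≡P = suc-pred P {{m^n≢0 2 (suc (suc a))}}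
  R≥2 : 2 ≤ R
  R≥2 = ≤-trans (n≤1+n 2) (pred-mono-≤ (^-monoʳ-≤ 2 {2} {suc (suc a)} (s≤s (s≤s z≤n))))
  -- σ(2^(a+1)·m) + σ(m) = P·σ(m) together with σ(2^(a+1)·m) = 2·2^(a+1)·m = P·m
  perfect-equation : suc R * m + σ m ≡ suc R * σ m
  perfect-equation = begin
    suc R * m + σ m                ≡⟨ cong (λ x → x * m + σ m) 1+R≡P ⟩
    P * m + σ m                    ≡⟨ cong (_+ σ m) (pow-suc (suc a) m) ⟩
    2 * (2 ^ suc a * m) + σ m      ≡⟨ cong (_+ σ m) (sym perfect) ⟩
    σ (2 ^ suc a * m) + σ m        ≡⟨ σ-pow (suc a) odd ⟩
    P * σ m                        ≡⟨ cong (_* σ m) (sym 1+R≡P) ⟩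
    suc R * σ m                    ∎
  conclude : Σ[ c ∈ ℕ ] (σ m ≡ m + c × m ≡ R * c) → (m + 1 ≡ P) × Irreducible m
  conclude (c , σm≡m+c , m≡Rc) with excess-is-one m≥1 R≥2 σm≡m+c m≡Rc
  ... | refl = trans (cong (_+ 1) (trans m≡Rc (*-identityʳ R))) (trans (+-comm R 1) 1+R≡P)
             , σ≡m+1⇒irreducible m≥1 σm≡m+c

-- The 2-adic decomposition

record TwoAdic (n : ℕ) : Set where
  constructor decomposition
  field
    exponent oddPart : ℕ
    oddPart-odd      : Odd oddPart
    split            : n ≡ 2 ^ exponent * oddPart

twoAdic : ∀ {n} → 1 ≤ n → TwoAdic n
twoAdic {n} n≥1 = go n≥1 (<-wellFounded n)
  where
  double : ∀ {q} → TwoAdic q → TwoAdic (q * 2)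
  double {q} (decomposition a m odd q≡) =
    decomposition (suc a) m odd (trans (*-comm q 2) (trans (cong (2 *_) q≡) (sym (pow-suc a m))))
  go : ∀ {n} → 1 ≤ n → Acc _<_ n → TwoAdic n
  go {n} n≥1 (acc smaller) with 2 ∣? n
  ... | no  odd                   = decomposition 0 n odd (sym (*-identityˡ n))
  ... | yes (divides-refl zero)   = ⊥-elim (1+n≰n n≥1)
  ... | yes (divides-refl q@(suc _)) = double (go (s≤s z≤n) (smaller (m<m*n q 2 (s≤s (s≤s z≤n)))))

twoAdic-unique : ∀ i j {q q′} → Odd q → Odd q′ → 2 ^ i * q ≡ 2 ^ j * q′ → i ≡ j × q ≡ q′
twoAdic-unique zero    zero    {q} {q′} _ _ eq =
  refl , trans (sym (*-identityˡ q)) (trans eq (*-identityˡ q′))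
twoAdic-unique zero    (suc j) {q} {q′} q-odd _ eq =
  ⊥-elim (q-odd (subst (2 ∣_) (trans (sym eq) (*-identityˡ q)) (even-pow j q′)))
twoAdic-unique (suc i) zero    {q} {q′} _ q′-odd eq =
  ⊥-elim (q′-odd (subst (2 ∣_) (trans eq (*-identityˡ q′)) (even-pow i q)))
twoAdic-unique (suc i) (suc j) {q} {q′} q-odd q′-odd eq
  with twoAdic-unique i j q-odd q′-odd
         (*-cancelˡ-≡ _ _ 2 (trans (sym (pow-suc i q)) (trans eq (pow-suc j q′))))
... | refl , q≡q′ = refl , q≡q′

-- Perfect multiples of δ = 2^(i+1)·o

multiple-split : ∀ i j {o t t′} → t ≡ 2 ^ j * t′ → t * (2 ^ suc i * o) ≡ 2 ^ suc (i + j) * (o * t′)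
multiple-split i j {o} {t′ = t′} refl = begin
  2 ^ j * t′ * (2 ^ suc i * o)     ≡⟨ rearrange (2 ^ j) t′ (2 ^ suc i) o ⟩
  2 ^ suc i * 2 ^ j * (o * t′)     ≡⟨ cong (_* (o * t′)) (sym (^-distribˡ-+-* 2 (suc i) j)) ⟩
  2 ^ suc (i + j) * (o * t′)       ∎
  where
  open ≡-Reasoning
  open +-*-Solver
  rearrange : ∀ A x B y → A * x * (B * y) ≡ B * A * (y * x)
  rearrange = solve 4 (λ A x B y → (A :* x) :* (B :* y) := (B :* A) :* (y :* x)) refl

-- Writing a perfect multiple t·δ as 2^(i+j+1)·(o·t′) with t = 2^j·t′, t′ odd,
-- Euler's theorem makes its odd part o·t′ the Mersenne prime 2^(i+j+2) − 1
record PerfectMultiple (i o t : ℕ) : Set where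
  constructor perfectMultiple
  field
    j t′     : ℕ
    t′-odd   : Odd t′
    t-split  : t ≡ 2 ^ j * t′
    mersenne : o * t′ + 1 ≡ 2 ^ suc (suc (i + j))
    prime    : Irreducible (o * t′)

perfectMultiple-shape : ∀ i {o t} → Odd o → 1 ≤ t →
  Perfect (t * (2 ^ suc i * o)) → PerfectMultiple i o t
perfectMultiple-shape i {o} {t} o-odd t≥1 perfect = shape (twoAdic t≥1)
  where
  shape : TwoAdic t → PerfectMultiple i o t
  shape (decomposition j t′ t′-odd t≡) =
    let mersenne , prime = evenPerfect⇒mersenne (i + j) (odd-* o-odd t′-odd)
                             (subst Perfect (multiple-split i j t≡) perfect)
    in perfectMultiple j t′ t′-odd t≡ mersenne prime

mersenne≢1 : ∀ a {m} → m + 1 ≡ 2 ^ suc (suc a) → m ≢ 1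
mersenne≢1 a eq refl = <⇒≢ (≤-trans (n≤1+n 3) (^-monoʳ-≤ 2 {2} {suc (suc a)} (s≤s (s≤s z≤n)))) eq

mersenne-exponent : ∀ a b {m} → m + 1 ≡ 2 ^ suc (suc a) → m + 1 ≡ 2 ^ suc (suc b) →
  2 ^ suc a * m ≡ 2 ^ suc b * m
mersenne-exponent a b {m} ea eb = cong (_* m) (*-cancelˡ-≡ (2 ^ suc a) (2 ^ suc b) 2 (trans (sym ea) eb))

-- if o ≠ 1 then o, dividing both Mersenne primes o·t′ and o·t″, equals both;
-- they then determine the same perfect number, so k·δ = (k+1)·δ
nontrivial-oddPart : ∀ i {o k} → Odd o → o ≢ 1 →
  PerfectMultiple i o k → PerfectMultiple i o (suc k) → ⊥
nontrivial-oddPart i {o} {k} o-odd o≢1 (perfectMultiple j t′ _ k≡ mers prime)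
                                       (perfectMultiple j′ t″ _ 1+k≡ mers′ prime′) =
  <⇒≢ δ≥1 (sym (+-cancelʳ-≡ (k * δ) δ 0 (sym same-multiple)))
  where
  open ≡-Reasoning
  δ : ℕ
  δ = 2 ^ suc i * o
  δ≥1 : 1 ≤ δ
  δ≥1 = 2^a*m-positive (suc i) (odd⇒positive o-odd)
  is-o : ∀ {t} → Irreducible (o * t) → o ≡ o * t
  is-o {t} irreducible with irreducible (m∣m*n t)
  ... | inj₁ o≡1   = ⊥-elim (o≢1 o≡1)
  ... | inj₂ o≡o*t = o≡o*t
  same-multiple : k * δ ≡ suc k * δ
  same-multiple = begin
    k * δ                    ≡⟨ multiple-split i j k≡ ⟩
    2 ^ suc (i + j) * (o * t′)  ≡⟨ cong (2 ^ suc (i + j) *_) (sym (is-o prime)) ⟩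
    2 ^ suc (i + j) * o      ≡⟨ mersenne-exponent (i + j) (i + j′)
                                  (trans (cong (_+ 1) (is-o prime)) mers)
                                  (trans (cong (_+ 1) (is-o prime′)) mers′) ⟩
    2 ^ suc (i + j′) * o     ≡⟨ cong (2 ^ suc (i + j′) *_) (is-o prime′) ⟩
    2 ^ suc (i + j′) * (o * t″) ≡⟨ sym (multiple-split i j′ 1+k≡) ⟩
    suc k * δ                ∎

-- t + 1 = Y·(Y·t + 2) has no solution with Y ≥ 1: the right side is at least t + 2
overshoot : ∀ {Y} t → 1 ≤ Y → t + 1 ≢ Y * (Y * t + 2)
overshoot {Y} t Y≥1 = <⇒≢ (begin-strict
  t + 1               <⟨ +-monoʳ-< t (s≤s (s≤s z≤n)) ⟩
  t + 2               ≤⟨ +-monoˡ-≤ 2 (m≤n*m t Y) ⟩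
  Y * t + 2           ≤⟨ m≤n*m (Y * t + 2) Y ⟩
  Y * (Y * t + 2)     ∎)
  where
  open ≤-Reasoning
  instance
    Y≢0 : NonZero Y
    Y≢0 = >-nonZero Y≥1

-- if δ = 2^(i+1) then one of k, k + 1 is odd.  If k is odd, k + 1 = 2^(i+2) has odd
-- part 1, which is no Mersenne prime.  If k = 2^(j+1)·t′ then k + 1 is odd, hence its
-- own Mersenne prime 2^(i+2) − 1, and t′ + 1 = 2^(j+1)·(k + 2) overshoots.
powerOfTwo-case : ∀ i {o k} → o ≡ 1 →
  PerfectMultiple i o k → PerfectMultiple i o (suc k) → ⊥
powerOfTwo-case i {k = k} refl (perfectMultiple zero t′ _ k≡ mers _)
                               (perfectMultiple j′ t″ t″-odd 1+k≡ mers′ _) =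
  mersenne≢1 (i + j′) mers′ (trans (*-identityˡ t″) (sym 1≡t″))
  where
  k+1-power : 2 ^ suc (suc (i + 0)) * 1 ≡ 2 ^ j′ * t″
  k+1-power = begin
    2 ^ suc (suc (i + 0)) * 1  ≡⟨ *-identityʳ _ ⟩
    2 ^ suc (suc (i + 0))      ≡⟨ sym mers ⟩
    1 * t′ + 1                 ≡⟨ cong (_+ 1) (sym k≡) ⟩
    k + 1                      ≡⟨ +-comm k 1 ⟩
    suc k                      ≡⟨ 1+k≡ ⟩
    2 ^ j′ * t″                ∎
    where open ≡-Reasoning
  1≡t″ : 1 ≡ t″
  1≡t″ with twoAdic-unique (suc (suc (i + 0))) j′ (odd-suc (2 ∣0)) t″-odd k+1-power
  ... | _ , eq = eq
powerOfTwo-case i {k = k} refl (perfectMultiple (suc j) t′ _ k≡ mers _)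
                               (perfectMultiple j′ t″ t″-odd 1+k≡ mers′ _)
  with twoAdic-unique 0 j′ (odd-suc (subst (2 ∣_) (sym k≡) (even-pow j t′))) t″-odd
         (trans (*-identityˡ (suc k)) 1+k≡)
... | refl , 1+k≡t″ = overshoot {Y} t′ (m^n>0 2 (suc j)) (begin
  t′ + 1                               ≡⟨ cong (_+ 1) (sym (*-identityˡ t′)) ⟩
  1 * t′ + 1                           ≡⟨ mers ⟩
  2 ^ suc (suc (i + suc j))            ≡⟨ cong (2 ^_) exponent ⟩
  2 ^ (suc j + suc (suc (i + 0)))      ≡⟨ ^-distribˡ-+-* 2 (suc j) _ ⟩
  Y * 2 ^ suc (suc (i + 0))            ≡⟨ cong (Y *_) (sym mers′) ⟩
  Y * (1 * t″ + 1)                     ≡⟨ cong (λ x → Y * (x + 1)) (trans (*-identityˡ t″) (sym 1+k≡t″)) ⟩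
  Y * (suc k + 1)                      ≡⟨ cong (Y *_) (sym (+-suc k 1)) ⟩
  Y * (k + 2)                          ≡⟨ cong (λ x → Y * (x + 2)) k≡ ⟩
  Y * (Y * t′ + 2)                     ∎)
  where
  open ≡-Reasoning
  Y : ℕ
  Y = 2 ^ suc j
  exponent : suc (suc (i + suc j)) ≡ suc j + suc (suc (i + 0))
  exponent = trans (cong (λ x → suc (suc (x + suc j))) (sym (+-identityʳ i)))
                   (+-comm (suc (suc (i + 0))) (suc j))

consecutive-multiples : ∀ i {o k} → Odd o → 1 ≤ k →
  Perfect (k * (2 ^ suc i * o)) → Perfect (suc k * (2 ^ suc i * o)) → ⊥
consecutive-multiples i {o} {k} o-odd k≥1 perfect perfect′ = by-oddPart (o ≟ 1)
  where
  multiple : PerfectMultiple i o k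
  multiple = perfectMultiple-shape i o-odd k≥1 perfect
  multiple′ : PerfectMultiple i o (suc k)
  multiple′ = perfectMultiple-shape i o-odd (s≤s z≤n) perfect′
  by-oddPart : Dec (o ≡ 1) → ⊥
  by-oddPart (yes o≡1) = powerOfTwo-case i o≡1 multiple multiple′
  by-oddPart (no  o≢1) = nontrivial-oddPart i o-odd o≢1 multiple multiple′

-- n = k·δ with k ≥ 1 as n > 0, and n + δ = (k+1)·δ; writing δ = 2^i·o with o odd,
-- i = 0 is excluded as δ is even
lemma2p2 : (n δ : ℕ) → 1 ≤ n → 2 ≤ δ → 2 ∣ δ →
    Perfect n → Perfect (n + δ) → ¬ (δ ∣ n)
lemma2p2 n δ n≥1 _ _ _ _ (divides zero n≡0) = 1+n≰n (subst (1 ≤_) n≡0 n≥1)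
lemma2p2 n δ n≥1 δ≥2 2∣δ perfect perfect′ (divides (suc k) n≡)
  with twoAdic (≤-trans (s≤s z≤n) δ≥2)
... | decomposition zero    o o-odd δ≡ = o-odd (subst (2 ∣_) (trans δ≡ (*-identityˡ o)) 2∣δ)
... | decomposition (suc i) o o-odd refl =
  consecutive-multiples i {k = suc k} o-odd (s≤s z≤n) (subst Perfect n≡ perfect)
    (subst Perfect (trans (cong (_+ δ) n≡) (+-comm (suc k * δ) δ)) perfect′)
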